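{- Let $n \ge 3$ and let $P_{\min_{n,n-3}} = \{1, F(1), F(2), \ldots, F(n-1)\}$ (the Fibonacci sequence shifted one place right, the minimizing $(n-3)$-ordered sequence). Let $T$ be the elongated binary tree of size $n$ that is the Huffman tree of $P_{\min_{n,n-3}}$. Then $$E(T, P_{\min_{n,n-3}}) = F(n+3) - 3.$$
   Context: $F(i)$ denotes the $i$-th Fibonacci number: $F(0)=0$, $F(1)=1$, $F(i)=F(i-1)+F(i-2)$ for $i>1$. A (strictly) binary tree is an ordered rooted tree in which every non-leaf node has exactly two children; its size is its number of leaves. A binary tree is elongated if among any two sibling nodes at least one is a leaf. For a binary tree $T$ with positive weights $p_1,\dots,p_n$ at its leaves, the weighted external path length is $E(T,P)=\sum_{i=1}^n l_i p_i$, where $l_i$ is the length of the path from the root to leaf $i$. Huffman algorithm on a non-decreasing sequence $P$ of positive integers repeatedly replaces the two smallest weights by their sum (re-sorting each time) until one weight remains; the merges define a Huffman tree of $P$. -}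

module Defs where

open import Data.Nat using (ℕ; zero; suc; _+_; _*_; _≤_)
open import Data.List using (List; []; _∷_; map; upTo)
open import Data.List.Relation.Unary.All using (All)
open import Data.List.Relation.Binary.Permutation.Propositional using (_↭_)
open import Data.Sum using (_⊎_)
open import Data.Product using (_×_)
open import Data.Unit using (⊤)
open import Data.Empty using (⊥)

fib : ℕ → ℕ
fib zero = 0
fib (suc zero) = 1
fib (suc (suc n)) = fib (suc n) + fib n

data Tree : Set where
  leaf : ℕ → Tree
  node : Tree → Tree → Tree

leaves : Tree → List ℕ
leaves (leaf p) = p ∷ []
leaves (node l r) = Data.List._++_ (leaves l) (leaves r)

weight : Tree → ℕ
weight (leaf p) = p
weight (node l r) = weight l + weight r

IsLeaf : Tree → Set
IsLeaf (leaf _) = ⊤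
IsLeaf (node _ _) = ⊥

Elongated : Tree → Set
Elongated (leaf _) = ⊤
Elongated (node l r) = (IsLeaf l ⊎ IsLeaf r) × Elongated l × Elongated r

pathLen : ℕ → Tree → ℕ
pathLen d (leaf p) = d * p
pathLen d (node l r) = pathLen (suc d) l + pathLen (suc d) r

E : Tree → ℕ
E t = pathLen 0 t

-- The forest is a multiset (up to permutation), which covers re-sorting
-- and all ways of breaking ties.
data HuffStep : List Tree → List Tree → Set where
  step : ∀ {F} a b rest → F ↭ (a ∷ b ∷ rest) → weight a ≤ weight b →
         All (λ x → weight b ≤ weight x) rest →
         HuffStep F (node a b ∷ rest)

data HuffRun : List Tree → Tree → Set where
  done : ∀ t → HuffRun (t ∷ []) t
  more : ∀ {F G t} → HuffStep F G → HuffRun G t → HuffRun F t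

IsHuffmanTree : List ℕ → Tree → Set
IsHuffmanTree P T = HuffRun (map leaf P) T

Pmin : ℕ → List ℕ
Pmin zero = []
Pmin (suc m) = 1 ∷ map (λ i → fib (suc i)) (upTo m)

-- Each Huffman merge pushes the two merged trees one level down, so E(T) is the
-- sum of the weights of all merged nodes. On P_min the forest always has weights
-- F(k), F(k+1), F(k+1), F(k+2), …, F(k+j): the two smallest are forced to weigh
-- F(k) and F(k+1), and their merge F(k+2) restores the same shape with k+1.
-- Hence E(T) = F(3) + F(4) + … + F(n+1) = F(n+3) − F(4).
module Submission where

open import Defs
open import Data.Nat using (ℕ; zero; suc; _+_; _*_; _∸_; _≤_; z≤n; s≤s)
open import Data.Nat.Properties
open import Data.Nat.ListAction using (sum)
open import Data.Nat.ListAction.Properties using (sum-↭)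
open import Data.Nat.Solver using (module +-*-Solver)
open import Data.List using (List; []; _∷_; length; map; applyUpTo)
open import Data.List.Properties using (map-∘; map-id; map-upTo)
open import Data.List.Membership.Propositional using (_∈_)
open import Data.List.Relation.Unary.Any using (here; there)
open import Data.List.Relation.Unary.All as All using (All; []; _∷_)
open import Data.List.Relation.Unary.All.Properties using (map⁺)
open import Data.List.Relation.Binary.Permutation.Propositional
  using (_↭_; prep; swap; ↭-refl; ↭-sym; ↭-trans)
open import Data.List.Relation.Binary.Permutation.Propositional.Properties
  using (↭-length; drop-∷; ∈-resp-↭)
  renaming (map⁺ to ↭-map⁺)
open import Data.Product using (_×_; _,_)
open import Relation.Binary.PropositionalEquality
  using (_≡_; refl; sym; trans; cong; cong₂; subst; module ≡-Reasoning)

open +-*-Solver using (solve; _:+_; _:=_)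

pathLen-suc : ∀ d t → pathLen (suc d) t ≡ pathLen d t + weight t
pathLen-suc d (leaf p) = +-comm p (d * p)
pathLen-suc d (node l r)
  rewrite pathLen-suc (suc d) l | pathLen-suc (suc d) r =
  solve 4 (λ a b c e → (a :+ b) :+ (c :+ e) := (a :+ c) :+ (b :+ e)) refl
    (pathLen (suc d) l) (weight l) (pathLen (suc d) r) (weight r)

E-node : ∀ a b → E (node a b) ≡ E a + E b + weight (node a b)
E-node a b rewrite pathLen-suc 0 a | pathLen-suc 0 b =
  solve 4 (λ x y z w → (x :+ y) :+ (z :+ w) := (x :+ z) :+ (y :+ w)) refl
    (E a) (weight a) (E b) (weight b)

mergeCost : ∀ {F t} → HuffRun F t → ℕ
mergeCost (done _) = 0
mergeCost (more (step a b _ _ _ _) r) = weight (node a b) + mergeCost r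

E-huffRun : ∀ {F t} (r : HuffRun F t) → E t ≡ sum (map E F) + mergeCost r
E-huffRun (done t) = sym (trans (+-identityʳ _) (+-identityʳ (E t)))
E-huffRun {F} {t} (more (step a b rest F↭ _ _) r) = begin
  E t
    ≡⟨ E-huffRun r ⟩
  E (node a b) + s + mergeCost r
    ≡⟨ cong (λ x → x + s + mergeCost r) (E-node a b) ⟩
  E a + E b + w + s + mergeCost r
    ≡⟨ solve 5 (λ x y v z c → x :+ y :+ v :+ z :+ c := x :+ (y :+ z) :+ (v :+ c)) refl
         (E a) (E b) w s (mergeCost r) ⟩
  sum (map E (a ∷ b ∷ rest)) + (w + mergeCost r)
    ≡⟨ cong (_+ (w + mergeCost r)) (sym (sum-↭ (↭-map⁺ E F↭))) ⟩
  sum (map E F) + (w + mergeCost r)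
    ∎
  where
  open ≡-Reasoning
  s w : ℕ
  s = sum (map E rest)
  w = weight (node a b)

sum-E-leaves : ∀ P → sum (map E (map leaf P)) ≡ 0
sum-E-leaves [] = refl
sum-E-leaves (_ ∷ P) = sum-E-leaves P

weights-leaves : ∀ P → map weight (map leaf P) ≡ P
weights-leaves P = trans (sym (map-∘ P)) (map-id P)

mergeCost-singleton : ∀ {t t′} (r : HuffRun (t ∷ []) t′) → mergeCost r ≡ 0
mergeCost-singleton (done _) = refl
mergeCost-singleton (more (step _ _ _ t↭ _ _) _) with ↭-length t↭
... | ()

least-≤ : ∀ {x y xs} → All (x ≤_) xs → y ∈ x ∷ xs → x ≤ y
least-≤ _ (here refl) = ≤-refl
least-≤ x≤xs (there y∈xs) = All.lookup x≤xs y∈xs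

↭-least-head : ∀ {x y xs ys} → All (x ≤_) xs → All (y ≤_) ys →
  x ∷ xs ↭ y ∷ ys → x ≡ y
↭-least-head x≤xs y≤ys p =
  ≤-antisym (least-≤ x≤xs (∈-resp-↭ (↭-sym p) (here refl)))
            (least-≤ y≤ys (∈-resp-↭ p (here refl)))

↭-two-least : ∀ {u v us x y xs} → u ≤ v → All (v ≤_) us → x ≤ y → All (y ≤_) xs →
  u ∷ v ∷ us ↭ x ∷ y ∷ xs → u ≡ x × v ≡ y × us ↭ xs
↭-two-least u≤v v≤us x≤y y≤xs p
  with ↭-least-head (u≤v ∷ All.map (≤-trans u≤v) v≤us) (x≤y ∷ All.map (≤-trans x≤y) y≤xs) p
... | refl with ↭-least-head v≤us y≤xs (drop-∷ p)
... | refl = refl , refl , drop-∷ (drop-∷ p)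

fib-mono : ∀ k → fib k ≤ fib (suc k)
fib-mono zero = z≤n
fib-mono (suc k) = m≤m+n (fib (suc k)) (fib k)

fib-merge : ∀ k → fib k + fib (suc k) ≡ fib (2 + k)
fib-merge k = +-comm (fib k) (fib (suc k))

fibsFrom : ℕ → ℕ → List ℕ
fibsFrom k zero = []
fibsFrom k (suc j) = fib k ∷ fibsFrom (suc k) j

fib≤fibsFrom : ∀ k j → All (fib k ≤_) (fibsFrom k j)
fib≤fibsFrom k zero = []
fib≤fibsFrom k (suc j) = ≤-refl ∷ All.map (≤-trans (fib-mono k)) (fib≤fibsFrom (suc k) j)

applyUpTo-fib : ∀ {f : ℕ → ℕ} k m → (∀ i → f i ≡ fib (k + i)) → applyUpTo f m ≡ fibsFrom k m
applyUpTo-fib k zero _ = refl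
applyUpTo-fib k (suc m) f≗ =
  cong₂ _∷_ (trans (f≗ 0) (cong fib (+-identityʳ k)))
            (applyUpTo-fib (suc k) m (λ i → trans (f≗ (suc i)) (cong fib (+-suc k i))))

Pmin-suc : ∀ m → Pmin (suc m) ≡ 1 ∷ fibsFrom 1 m
Pmin-suc m = cong (1 ∷_) (trans (map-upTo _ m) (applyUpTo-fib 1 m (λ _ → refl)))

fibForest : ℕ → ℕ → List ℕ
fibForest k j = fib k ∷ fib (suc k) ∷ fibsFrom (suc k) j

huffStep-fibForest : ∀ {k j a b rest F} → F ↭ a ∷ b ∷ rest → weight a ≤ weight b →
  All (λ x → weight b ≤ weight x) rest → map weight F ↭ fibForest k j →
  weight (node a b) ≡ fib (2 + k) × map weight rest ↭ fibsFrom (suc k) j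
huffStep-fibForest {k} {j} F↭ a≤b b≤rest F≈
  with ↭-two-least a≤b (map⁺ b≤rest) (fib-mono k) (fib≤fibsFrom (suc k) j)
         (↭-trans (↭-sym (↭-map⁺ weight F↭)) F≈)
... | a≡ , b≡ , rest≈ = trans (cong₂ _+_ a≡ b≡) (fib-merge k) , rest≈

mergeCost-fibForest : ∀ k j {F t} (r : HuffRun F t) → map weight F ↭ fibForest k j →
  mergeCost r + fib (3 + k) ≡ fib (j + (4 + k))
mergeCost-fibForest k j (done _) F≈ with ↭-length F≈
... | ()
mergeCost-fibForest k j (more (step a b rest F↭ a≤b b≤rest) r) F≈
  with huffStep-fibForest F↭ a≤b b≤rest F≈
... | merged , rest≈ rewrite merged = after-merge j rest r rest≈
  where
  open ≡-Reasoning
  after-merge : ∀ j rest {t} (r : HuffRun (node a b ∷ rest) t) →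
    map weight rest ↭ fibsFrom (suc k) j → fib (2 + k) + mergeCost r + fib (3 + k) ≡ fib (j + (4 + k))
  after-merge zero [] r _ rewrite mergeCost-singleton r | +-identityʳ (fib (2 + k)) =
    +-comm (fib (2 + k)) (fib (3 + k))
  after-merge zero (_ ∷ _) _ rest≈ with ↭-length rest≈
  ... | ()
  after-merge (suc j) rest r rest≈ = begin
    fib (2 + k) + mergeCost r + fib (3 + k)
      ≡⟨ solve 3 (λ x c y → x :+ c :+ y := c :+ (y :+ x)) refl
           (fib (2 + k)) (mergeCost r) (fib (3 + k)) ⟩
    mergeCost r + fib (4 + k)
      ≡⟨ mergeCost-fibForest (suc k) j r merged≈ ⟩
    fib (j + (5 + k))
      ≡⟨ cong fib (+-suc j (4 + k)) ⟩
    fib (suc j + (4 + k))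
      ∎
    where
    merged≈ : map weight (node a b ∷ rest) ↭ fibForest (suc k) j
    merged≈ = ↭-trans (prep _ rest≈)
      (subst (λ x → x ∷ fib (suc k) ∷ fibsFrom (2 + k) j ↭ fibForest (suc k) j)
             (sym merged) (swap _ _ ↭-refl))

corollary4 : (n : ℕ) → 3 ≤ n → (T : Tree) → length (leaves T) ≡ n →
    Elongated T → IsHuffmanTree (Pmin n) T → E T ≡ fib (n + 3) ∸ 3
corollary4 .(3 + i) (s≤s (s≤s (s≤s (z≤n {i})))) T _ _ run = begin
  E T
    ≡⟨ E-huffRun run ⟩
  sum (map E (map leaf (Pmin (3 + i)))) + mergeCost run
    ≡⟨ cong (_+ mergeCost run) (sum-E-leaves (Pmin (3 + i))) ⟩
  mergeCost run
    ≡⟨ sym (m+n∸n≡m (mergeCost run) 3) ⟩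
  mergeCost run + fib 4 ∸ 3
    ≡⟨ cong (_∸ 3) (mergeCost-fibForest 1 (suc i) run leaves≈) ⟩
  fib (suc i + 5) ∸ 3
    ≡⟨ cong (λ m → fib (suc m) ∸ 3) (trans (+-suc i 4) (cong suc (+-suc i 3))) ⟩
  fib (3 + i + 3) ∸ 3
    ∎
  where
  open ≡-Reasoning
  leaves≈ : map weight (map leaf (Pmin (3 + i))) ↭ fibForest 1 (suc i)
  leaves≈ rewrite weights-leaves (Pmin (3 + i)) | Pmin-suc (2 + i) = ↭-refl
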